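{- Let $w\in\mathcal{M}$ with $H_{NE}(w,z)=\sum_{i\in\mathbb{Z}}a_iz^i$ and $H_{SE}(w,z)=\sum_{i\in\mathbb{Z}}b_iz^i$. Then the number of words $u\in\mathcal{M}$ with $u\overset{\mathrm{bal}}{\sim}w$ equals $$\prod_{i\ge0}\binom{a_i+b_{i+2}-1}{b_{i+2}}\binom{b_{ -i}+a_{ -i-2}-1}{a_{ -i-2}}\times\begin{cases}\binom{a_0+b_0}{a_0}, & w \text{ balanced},\\ \binom{a_0+b_0-1}{b_0}, & w\text{ rising and not balanced},\\ \binom{a_0+b_0-1}{a_0}, & w\text{ falling and not balanced}.\end{cases}$$
   Context: $\mathcal{M}$ is the free monoid on letters $D,U$. For $w=w_1\cdots w_N$ and $0\le i\le N$ let $h_i=(\#U\text{'s}-\#D\text{'s in }w_1\cdots w_i)$. $H_{NE}(w,z)=\sum_{0\le i<N,\,w_{i+1}=U}z^{h_i}$ and $H_{SE}(w,z)=\sum_{0\le i<N,\,w_{i+1}=D}z^{h_i}$ (Laurent polynomials, so $a_i=b_i=0$ for all but finitely many $i$). A word is balanced / rising / falling if it has equally many / at least as many $U$'s as $D$'s / at least as many $D$'s as $U$'s. A balanced commutation turns $pyxq$ into $pxyq$ for words $p,q$ and balanced words $x,y$; $\overset{\mathrm{bal}}{\sim}$ is the equivalence relation generated by balanced commutations. Binomial coefficients are the usual ones with $\binom{ -1}{0}=1$. -}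

module Defs where

open import Data.Nat as ℕ using (ℕ; zero; suc; _≤?_)
open import Data.Nat.Combinatorics using (_C_)
open import Data.Integer as ℤ using (ℤ; +_; -[1+_]; _-_; _≟_)
open import Data.List using (List; []; _∷_; _++_; length; map; upTo)
open import Data.Nat.ListAction using (product)
open import Data.List.Membership.Propositional using (_∈_)
open import Data.List.Relation.Unary.Unique.Propositional using (Unique)
open import Data.Product using (Σ; _×_)
open import Function.Bundles using (_⇔_)
open import Relation.Nullary using (yes; no)
open import Relation.Binary.PropositionalEquality using (_≡_)
open import Relation.Binary.Construct.Closure.Equivalence using (EqClosure)

data Letter : Set where
  D U : Letter

Word : Set
Word = List Letter

#U : Word → ℕ
#U []       = 0
#U (U ∷ w) = suc (#U w)
#U (D ∷ w) = #U w

#D : Word → ℕ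
#D []       = 0
#D (D ∷ w) = suc (#D w)
#D (U ∷ w) = #D w

Balanced : Word → Set
Balanced w = #U w ≡ #D w

Rising : Word → Set
Rising w = #D w ℕ.≤ #U w

Falling : Word → Set
Falling w = #U w ℕ.≤ #D w

step : Letter → ℤ
step U = + 1
step D = -[1+ 0 ]

ind : {P : Set} → Relation.Nullary.Dec P → ℕ
ind (yes _) = 1
ind (no _)  = 0

coeffFrom : Letter → ℤ → Word → ℤ → ℕ
coeffFrom ℓ h []      t = 0
coeffFrom U h (U ∷ w) t = ind (h ≟ t) ℕ.+ coeffFrom U (h ℤ.+ step U) w t
coeffFrom U h (D ∷ w) t = coeffFrom U (h ℤ.+ step D) w t
coeffFrom D h (D ∷ w) t = ind (h ≟ t) ℕ.+ coeffFrom D (h ℤ.+ step D) w t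
coeffFrom D h (U ∷ w) t = coeffFrom D (h ℤ.+ step U) w t

-- a i = coefficient of z^i in H_NE(w,z); b i = coefficient of z^i in H_SE(w,z)
a : Word → ℤ → ℕ
a w i = coeffFrom U (+ 0) w i

b : Word → ℤ → ℕ
b w i = coeffFrom D (+ 0) w i

-- binomial coefficient with integer top, only the convention binom(-1,0)=1 is needed
-- (top arguments in the theorem are ≥ -1, and = -1 only with bottom 0)
binomℤ : ℤ → ℕ → ℕ
binomℤ (+ n)      k    = n C k
binomℤ -[1+ 0 ]   zero = 1
binomℤ _          _    = 0

binom-1 : ℕ → ℕ → ℕ → ℕ
binom-1 x y k = binomℤ (+ (x ℕ.+ y) - + 1) k

factor : Word → ℕ → ℕ
factor w i =
  binom-1 (a w (+ i)) (b w (+ (i ℕ.+ 2))) (b w (+ (i ℕ.+ 2)))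
  ℕ.* binom-1 (b w (ℤ.- (+ i))) (a w (ℤ.- (+ (i ℕ.+ 2)))) (a w (ℤ.- (+ (i ℕ.+ 2))))

-- the product over i ≥ 0; all factors with i > length w equal binom(-1,0) = 1,
-- so the product is taken over i = 0 .. length w.
infProduct : Word → ℕ
infProduct w = product (map (factor w) (upTo (suc (length w))))

caseFactor : Word → ℕ
caseFactor w with #U w ℕ.≟ #D w
... | yes _ = (a w (+ 0) ℕ.+ b w (+ 0)) C a w (+ 0)
... | no _ with #D w ≤? #U w
...   | yes _ = binom-1 (a w (+ 0)) (b w (+ 0)) (b w (+ 0))
...   | no _  = binom-1 (a w (+ 0)) (b w (+ 0)) (a w (+ 0))

data BalComm : Word → Word → Set where
  comm : (p q x y : Word) → Balanced x → Balanced y →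
         BalComm (p ++ y ++ x ++ q) (p ++ x ++ y ++ q)

_∼bal_ : Word → Word → Set
_∼bal_ = EqClosure BalComm

HasCard : (Word → Set) → ℕ → Set
HasCard P n = Σ (List Word) λ us → Unique us × ((u : Word) → (u ∈ us) ⇔ P u) × length us ≡ n

-- Write α_e = a_{e-1} and β_e = b_{e+1} for the numbers of U- and D-steps of a word arriving at
-- height e. Balanced commutations preserve these numbers, the final height and the length, and
-- conversely words agreeing in them are ∼bal-equivalent. The converse is proved by peeling off the
-- last letter: the class of w, of final height e, contains a word ending in ℓ exactly when
-- CanEndWith ℓ e α_e β_e holds, and then its words ending in ℓ are the v ℓ with v in the class of a
-- word whose data differ from those of w by one ℓ-arrival at e. Hence class sizes obey a Pascal
-- recurrence at the single level e. The formula of the theorem is a product over all levels e of a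
-- binomial coefficient in (α_e, β_e) alone, and each of these obeys the same recurrence, so both sides
-- agree by induction on the length.

module Submission where

open import Defs
open import Data.Empty using (⊥; ⊥-elim)
open import Data.Integer as ℤ using (ℤ; +_; -[1+_]; _⊖_)
import Data.Integer.Properties as ℤP
open import Data.List using ([]; _∷_; _++_; length; map; upTo; initLast; _∷ʳ′_)
import Data.List.Properties as LP
open import Data.List.Membership.Propositional using (_∈_)
open import Data.List.Membership.Propositional.Properties using (∈-map⁻; ∈-map⁺; ∈-++⁻; ∈-++⁺ˡ; ∈-++⁺ʳ)
open import Data.List.Relation.Unary.All using ([])
open import Data.List.Relation.Unary.AllPairs using ([]; _∷_)
open import Data.List.Relation.Unary.Any using (here)
import Data.List.Relation.Unary.Unique.Propositional.Properties as Unique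
open import Data.Nat as ℕ using (ℕ; zero; suc; _+_; _*_; _∸_; _≤_; _<_; z≤n; s≤s)
open import Data.Nat.Combinatorics using (_C_; nCn≡1; nCk+nC[k+1]≡[n+1]C[k+1]; nCk≡nC[n∸k])
open import Data.Nat.ListAction using (product)
open import Data.Nat.ListAction.Properties using (product-++)
import Data.Nat.Properties as ℕP
open import Data.Nat.Tactic.RingSolver using (solve-∀)
open import Data.Product using (Σ-syntax; _×_; _,_; proj₁; proj₂)
open import Data.Sum using (_⊎_; inj₁; inj₂; [_,_]) renaming (map to ⊎-map)
open import Function using (_∘_)
open import Function.Bundles using (_⇔_; mk⇔; Equivalence)
open import Relation.Binary.PropositionalEquality hiding ([_])
open import Relation.Binary.Structures using (IsEquivalence)
import Relation.Binary.Construct.Closure.Equivalence as EqClosure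
open import Relation.Nullary using (¬_; Dec; yes; no)
open import Relation.Nullary.Decidable using (_⊎-dec_; _×-dec_)
open import Algebra.Properties.AbelianGroup ℤP.+-0-abelianGroup using (∙-cancelˡ)
open import Algebra.Properties.CommutativeSemigroup ℕP.+-commutativeSemigroup using (x∙yz≈y∙xz)

height : ℤ → Word → ℤ
height h []      = h
height h (c ∷ w) = height (h ℤ.+ step c) w

finalHeight : Word → ℤ
finalHeight = height (+ 0)

height-++ : ∀ h x y → height h (x ++ y) ≡ height (height h x) y
height-++ h []      y = refl
height-++ h (c ∷ x) y = height-++ (h ℤ.+ step c) x y

height-counts : ∀ h w → height h w ≡ h ℤ.+ (#U w ⊖ #D w)
height-counts h []      = sym (ℤP.+-identityʳ h)
height-counts h (U ∷ w) = begin
  height (h ℤ.+ + 1) w                 ≡⟨ height-counts _ w ⟩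
  h ℤ.+ + 1 ℤ.+ (#U w ⊖ #D w)          ≡⟨ ℤP.+-assoc h (+ 1) _ ⟩
  h ℤ.+ (+ 1 ℤ.+ (#U w ⊖ #D w))        ≡⟨ cong (ℤ._+_ h) (ℤP.distribʳ-⊖-+-pos 1 (#U w) (#D w)) ⟩
  h ℤ.+ (suc (#U w) ⊖ #D w)            ∎
  where open ≡-Reasoning
height-counts h (D ∷ w) = begin
  height (h ℤ.+ -[1+ 0 ]) w            ≡⟨ height-counts _ w ⟩
  h ℤ.+ -[1+ 0 ] ℤ.+ (#U w ⊖ #D w)     ≡⟨ ℤP.+-assoc h -[1+ 0 ] _ ⟩
  h ℤ.+ (-[1+ 0 ] ℤ.+ (#U w ⊖ #D w))   ≡⟨ cong (ℤ._+_ h) (ℤP.distribʳ-⊖-+-neg 0 (#U w) (#D w)) ⟩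
  h ℤ.+ (#U w ⊖ suc (#D w))            ∎
  where open ≡-Reasoning

⊖≡0⇒≡ : ∀ m n → m ⊖ n ≡ + 0 → m ≡ n
⊖≡0⇒≡ m n eq = ℤP.+-injective (ℤP.i-j≡0⇒i≡j (+ m) (+ n) (trans (ℤP.m-n≡m⊖n m n) eq))

height≡⇒Balanced : ∀ h w → height h w ≡ h → Balanced w
height≡⇒Balanced h w eq =
  ⊖≡0⇒≡ (#U w) (#D w) (∙-cancelˡ h _ _ (trans (sym (height-counts h w)) (trans eq (sym (ℤP.+-identityʳ h)))))

Balanced⇒height≡ : ∀ h w → Balanced w → height h w ≡ h
Balanced⇒height≡ h w bal = begin
  height h w                ≡⟨ height-counts h w ⟩
  h ℤ.+ (#U w ⊖ #D w)       ≡⟨ cong (λ n → h ℤ.+ (n ⊖ #D w)) bal ⟩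
  h ℤ.+ (#D w ⊖ #D w)       ≡⟨ cong (ℤ._+_ h) (ℤP.n⊖n≡0 (#D w)) ⟩
  h ℤ.+ + 0                 ≡⟨ ℤP.+-identityʳ h ⟩
  h                         ∎
  where open ≡-Reasoning

δ : Letter → ℤ → Letter → ℤ → ℕ
δ U h U t = ind (h ℤ.≟ t)
δ D h D t = ind (h ℤ.≟ t)
δ U h D t = 0
δ D h U t = 0

coeffFrom-∷ : ∀ ℓ c h w t → coeffFrom ℓ h (c ∷ w) t ≡ δ c h ℓ t + coeffFrom ℓ (h ℤ.+ step c) w t
coeffFrom-∷ U U h w t = refl
coeffFrom-∷ U D h w t = refl
coeffFrom-∷ D U h w t = refl
coeffFrom-∷ D D h w t = refl

coeffFrom-++ : ∀ ℓ h x y t → coeffFrom ℓ h (x ++ y) t ≡ coeffFrom ℓ h x t + coeffFrom ℓ (height h x) y t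
coeffFrom-++ ℓ h []      y t = refl
coeffFrom-++ ℓ h (c ∷ x) y t = begin
  coeffFrom ℓ h (c ∷ x ++ y) t                                        ≡⟨ coeffFrom-∷ ℓ c h (x ++ y) t ⟩
  δ c h ℓ t + coeffFrom ℓ (h ℤ.+ step c) (x ++ y) t                    ≡⟨ cong (_+_ (δ c h ℓ t)) (coeffFrom-++ ℓ _ x y t) ⟩
  δ c h ℓ t + (coeffFrom ℓ (h ℤ.+ step c) x t + rest)                 ≡⟨ ℕP.+-assoc (δ c h ℓ t) _ rest ⟨
  δ c h ℓ t + coeffFrom ℓ (h ℤ.+ step c) x t + rest                   ≡⟨ cong (_+ rest) (coeffFrom-∷ ℓ c h x t) ⟨
  coeffFrom ℓ h (c ∷ x) t + rest                                      ∎
  where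
  open ≡-Reasoning
  rest = coeffFrom ℓ (height h (c ∷ x)) y t

coeffFrom-snoc : ∀ ℓ h w c t → coeffFrom ℓ h (w ++ c ∷ []) t ≡ coeffFrom ℓ h w t + δ c (height h w) ℓ t
coeffFrom-snoc ℓ h w c t =
  trans (coeffFrom-++ ℓ h w (c ∷ []) t)
        (cong (_+_ (coeffFrom ℓ h w t)) (trans (coeffFrom-∷ ℓ c _ [] t) (ℕP.+-identityʳ _)))

coeffFrom-Balanced-++ : ∀ ℓ h x r t → Balanced x → coeffFrom ℓ h (x ++ r) t ≡ coeffFrom ℓ h x t + coeffFrom ℓ h r t
coeffFrom-Balanced-++ ℓ h x r t bal =
  trans (coeffFrom-++ ℓ h x r t) (cong (λ h′ → coeffFrom ℓ h x t + coeffFrom ℓ h′ r t) (Balanced⇒height≡ h x bal))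

height-Balanced-++ : ∀ h x r → Balanced x → height h (x ++ r) ≡ height h r
height-Balanced-++ h x r bal = trans (height-++ h x r) (cong (λ h′ → height h′ r) (Balanced⇒height≡ h x bal))

-- Invariants of balanced commutation

record Invariants (u w : Word) : Set where
  field
    coeff≡  : ∀ ℓ t → coeffFrom ℓ (+ 0) u t ≡ coeffFrom ℓ (+ 0) w t
    height≡ : finalHeight u ≡ finalHeight w
    length≡ : length u ≡ length w

Invariants-isEquivalence : IsEquivalence Invariants
Invariants-isEquivalence = record
  { refl  = record { coeff≡ = λ _ _ → refl ; height≡ = refl ; length≡ = refl }
  ; sym   = λ i → let open Invariants i in
      record { coeff≡ = λ ℓ t → sym (coeff≡ ℓ t) ; height≡ = sym height≡ ; length≡ = sym length≡ }
  ; trans = λ i j → record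
      { coeff≡  = λ ℓ t → trans (Invariants.coeff≡ i ℓ t) (Invariants.coeff≡ j ℓ t)
      ; height≡ = trans (Invariants.height≡ i) (Invariants.height≡ j)
      ; length≡ = trans (Invariants.length≡ i) (Invariants.length≡ j) }
  }

coeffFrom-swap : ∀ ℓ h x y q t → Balanced x → Balanced y → coeffFrom ℓ h (y ++ x ++ q) t ≡ coeffFrom ℓ h (x ++ y ++ q) t
coeffFrom-swap ℓ h x y q t bx by = begin
  coeffFrom ℓ h (y ++ x ++ q) t          ≡⟨ coeffFrom-Balanced-++ ℓ h y _ t by ⟩
  cy + coeffFrom ℓ h (x ++ q) t          ≡⟨ cong (_+_ cy) (coeffFrom-Balanced-++ ℓ h x q t bx) ⟩
  cy + (cx + coeffFrom ℓ h q t)          ≡⟨ x∙yz≈y∙xz cy cx _ ⟩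
  cx + (cy + coeffFrom ℓ h q t)          ≡⟨ cong (_+_ cx) (coeffFrom-Balanced-++ ℓ h y q t by) ⟨
  cx + coeffFrom ℓ h (y ++ q) t          ≡⟨ coeffFrom-Balanced-++ ℓ h x _ t bx ⟨
  coeffFrom ℓ h (x ++ y ++ q) t          ∎
  where
  open ≡-Reasoning
  cx = coeffFrom ℓ h x t
  cy = coeffFrom ℓ h y t

height-swap : ∀ h x y q → Balanced x → Balanced y → height h (y ++ x ++ q) ≡ height h (x ++ y ++ q)
height-swap h x y q bx by = begin
  height h (y ++ x ++ q)     ≡⟨ height-Balanced-++ h y _ by ⟩
  height h (x ++ q)          ≡⟨ height-Balanced-++ h x q bx ⟩
  height h q                 ≡⟨ height-Balanced-++ h y q by ⟨
  height h (y ++ q)          ≡⟨ height-Balanced-++ h x _ bx ⟨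
  height h (x ++ y ++ q)     ∎
  where open ≡-Reasoning

length-swap : ∀ (x y q : Word) → length (y ++ x ++ q) ≡ length (x ++ y ++ q)
length-swap x y q = begin
  length (y ++ x ++ q)                   ≡⟨ LP.length-++ y ⟩
  length y + length (x ++ q)             ≡⟨ cong (_+_ (length y)) (LP.length-++ x) ⟩
  length y + (length x + length q)       ≡⟨ x∙yz≈y∙xz (length y) (length x) _ ⟩
  length x + (length y + length q)       ≡⟨ cong (_+_ (length x)) (LP.length-++ y) ⟨
  length x + length (y ++ q)             ≡⟨ LP.length-++ x ⟨
  length (x ++ y ++ q)                   ∎
  where open ≡-Reasoning

BalComm⇒Invariants : ∀ {u w} → BalComm u w → Invariants u w
BalComm⇒Invariants (comm p q x y bx by) = record
  { coeff≡  = λ ℓ t → begin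
      coeffFrom ℓ (+ 0) (p ++ y ++ x ++ q) t                  ≡⟨ coeffFrom-++ ℓ (+ 0) p _ t ⟩
      coeffFrom ℓ (+ 0) p t + coeffFrom ℓ hp (y ++ x ++ q) t  ≡⟨ cong (_+_ (coeffFrom ℓ (+ 0) p t)) (coeffFrom-swap ℓ hp x y q t bx by) ⟩
      coeffFrom ℓ (+ 0) p t + coeffFrom ℓ hp (x ++ y ++ q) t  ≡⟨ coeffFrom-++ ℓ (+ 0) p _ t ⟨
      coeffFrom ℓ (+ 0) (p ++ x ++ y ++ q) t                  ∎
  ; height≡ = begin
      finalHeight (p ++ y ++ x ++ q)     ≡⟨ height-++ (+ 0) p _ ⟩
      height hp (y ++ x ++ q)            ≡⟨ height-swap hp x y q bx by ⟩
      height hp (x ++ y ++ q)            ≡⟨ height-++ (+ 0) p _ ⟨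
      finalHeight (p ++ x ++ y ++ q)     ∎
  ; length≡ = begin
      length (p ++ y ++ x ++ q)          ≡⟨ LP.length-++ p ⟩
      length p + length (y ++ x ++ q)    ≡⟨ cong (_+_ (length p)) (length-swap x y q) ⟩
      length p + length (x ++ y ++ q)    ≡⟨ LP.length-++ p ⟨
      length (p ++ x ++ y ++ q)          ∎
  }
  where
  open ≡-Reasoning
  hp = finalHeight p

module ∼bal = IsEquivalence (EqClosure.isEquivalence BalComm)

∼bal⇒Invariants : ∀ {u w} → u ∼bal w → Invariants u w
∼bal⇒Invariants = EqClosure.fold Invariants-isEquivalence BalComm⇒Invariants

BalComm-snoc : ∀ s {u w} → BalComm u w → BalComm (u ++ s) (w ++ s)
BalComm-snoc s (comm p q x y bx by) =
  subst₂ BalComm (reassoc y x) (reassoc x y) (comm p (q ++ s) x y bx by)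
  where
  reassoc : ∀ x y → p ++ x ++ y ++ q ++ s ≡ (p ++ x ++ y ++ q) ++ s
  reassoc x y = begin
    p ++ x ++ y ++ q ++ s       ≡⟨ cong (λ z → p ++ x ++ z) (LP.++-assoc y q s) ⟨
    p ++ x ++ (y ++ q) ++ s     ≡⟨ cong (p ++_) (LP.++-assoc x (y ++ q) s) ⟨
    p ++ (x ++ y ++ q) ++ s     ≡⟨ LP.++-assoc p _ s ⟨
    (p ++ x ++ y ++ q) ++ s     ∎
    where open ≡-Reasoning

∼bal-snoc : ∀ s {u w} → u ∼bal w → (u ++ s) ∼bal (w ++ s)
∼bal-snoc s = EqClosure.gmap (_++ s) (BalComm-snoc s)

+1≡suc : ∀ h → h ℤ.+ + 1 ≡ ℤ.suc h
+1≡suc h = ℤP.+-comm h (+ 1)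

-1≡pred : ∀ h → h ℤ.+ -[1+ 0 ] ≡ ℤ.pred h
-1≡pred h = ℤP.+-comm h -[1+ 0 ]

≤+1 : ∀ h → h ℤ.≤ h ℤ.+ + 1
≤+1 h = subst (h ℤ.≤_) (sym (+1≡suc h)) (ℤP.i≤suc[i] h)

<+1 : ∀ h → h ℤ.< h ℤ.+ + 1
<+1 h = subst (h ℤ.<_) (sym (+1≡suc h)) (ℤP.suc[i]≤j⇒i<j ℤP.≤-refl)

-1≤ : ∀ h → h ℤ.+ -[1+ 0 ] ℤ.≤ h
-1≤ h = subst (ℤ._≤ h) (sym (-1≡pred h)) (ℤP.i≤j⇒pred[i]≤j ℤP.≤-refl)

<⇒+1≤ : ∀ {h t} → h ℤ.< t → h ℤ.+ + 1 ℤ.≤ t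
<⇒+1≤ {h} h<t = subst (ℤ._≤ _) (sym (+1≡suc h)) (ℤP.i<j⇒suc[i]≤j h<t)

<⇒≤-1 : ∀ {t h} → t ℤ.< h → t ℤ.≤ h ℤ.+ -[1+ 0 ]
<⇒≤-1 {h = h} t<h = subst (_ ℤ.≤_) (sym (-1≡pred h)) (ℤP.i<j⇒i≤pred[j] t<h)

<+1⇒≤ : ∀ {t h} → t ℤ.< h ℤ.+ + 1 → t ℤ.≤ h
<+1⇒≤ {h = h} t<h+1 = subst (_ ℤ.≤_) (ℤP.pred-suc h) (ℤP.i<j⇒i≤pred[j] (subst (_ ℤ.<_) (+1≡suc h) t<h+1))

source : Letter → ℤ → ℤ
source U = ℤ.pred
source D = ℤ.suc

source-step : ∀ c h → source c (h ℤ.+ step c) ≡ h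
source-step U h = trans (cong ℤ.pred (+1≡suc h)) (ℤP.pred-suc h)
source-step D h = trans (cong ℤ.suc (-1≡pred h)) (ℤP.suc-pred h)

step-source : ∀ c e → source c e ℤ.+ step c ≡ e
step-source U e = trans (+1≡suc (ℤ.pred e)) (ℤP.suc-pred e)
step-source D e = trans (-1≡pred (ℤ.suc e)) (ℤP.pred-suc e)

ind-yes : ∀ {P : Set} (p : Dec P) → P → ind p ≡ 1
ind-yes (yes _) _  = refl
ind-yes (no ¬p) p  = ⊥-elim (¬p p)

ind-no : ∀ {P : Set} (p : Dec P) → ¬ P → ind p ≡ 0
ind-no (yes p) ¬p = ⊥-elim (¬p p)
ind-no (no _)  _  = refl

ind-cong : ∀ {P Q : Set} (p : Dec P) (q : Dec Q) → (P → Q) → (Q → P) → ind p ≡ ind q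
ind-cong (yes _)  (yes _)  _ _ = refl
ind-cong (no _)   (no _)   _ _ = refl
ind-cong (yes p)  (no ¬q)  f _ = ⊥-elim (¬q (f p))
ind-cong (no ¬p)  (yes q)  _ g = ⊥-elim (¬p (g q))

δ-self : ∀ c h → δ c h c h ≡ 1
δ-self U h = ind-yes (h ℤ.≟ h) refl
δ-self D h = ind-yes (h ℤ.≟ h) refl

δ-≢ : ∀ c ℓ {h t} → h ≢ t → δ c h ℓ t ≡ 0
δ-≢ U U h≢t = ind-no (_ ℤ.≟ _) h≢t
δ-≢ D D h≢t = ind-no (_ ℤ.≟ _) h≢t
δ-≢ U D _   = refl
δ-≢ D U _   = refl

δ-positive : ∀ c h ℓ t → 1 ≤ δ c h ℓ t → c ≡ ℓ × h ≡ t
δ-positive U h U t pos with h ℤ.≟ t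
... | yes h≡t = refl , h≡t
δ-positive D h D t pos with h ℤ.≟ t
... | yes h≡t = refl , h≡t
δ-positive U h D t ()
δ-positive D h U t ()

δ-source : ∀ c h ℓ e → δ c h ℓ (source ℓ e) ≡ δ c (h ℤ.+ step c) ℓ e
δ-source U h U e = ind-cong (h ℤ.≟ _) (_ ℤ.≟ e)
  (λ eq → trans (cong (ℤ._+ + 1) eq) (step-source U e)) (λ eq → trans (sym (source-step U h)) (cong ℤ.pred eq))
δ-source D h D e = ind-cong (h ℤ.≟ _) (_ ℤ.≟ e)
  (λ eq → trans (cong (ℤ._+ -[1+ 0 ]) eq) (step-source D e)) (λ eq → trans (sym (source-step D h)) (cong ℤ.suc eq))
δ-source U h D e = refl
δ-source D h U e = refl

Profile : Set
Profile = Letter → ℤ → ℕ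

-- profile w U e = a_{e-1} and profile w D e = b_{e+1}.
profile : Word → Profile
profile w ℓ e = coeffFrom ℓ (+ 0) w (source ℓ e)

profile-snoc : ∀ v c ℓ e → profile (v ++ c ∷ []) ℓ e ≡ profile v ℓ e + δ c (finalHeight (v ++ c ∷ [])) ℓ e
profile-snoc v c ℓ e = begin
  profile (v ++ c ∷ []) ℓ e                                   ≡⟨ coeffFrom-snoc ℓ (+ 0) v c _ ⟩
  profile v ℓ e + δ c (finalHeight v) ℓ (source ℓ e)           ≡⟨ cong (_+_ (profile v ℓ e)) (δ-source c _ ℓ e) ⟩
  profile v ℓ e + δ c (finalHeight v ℤ.+ step c) ℓ e           ≡⟨ cong (λ h → profile v ℓ e + δ c h ℓ e) (height-++ (+ 0) v (c ∷ [])) ⟨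
  profile v ℓ e + δ c (finalHeight (v ++ c ∷ [])) ℓ e          ∎
  where open ≡-Reasoning

coeffFrom-++-≤ : ∀ ℓ h x y t → coeffFrom ℓ h x t ≤ coeffFrom ℓ h (x ++ y) t
coeffFrom-++-≤ ℓ h x y t = subst (_ ≤_) (sym (coeffFrom-++ ℓ h x y t)) (ℕP.m≤m+n _ _)

record LastStep (ℓ : Letter) (h : ℤ) (w : Word) (t : ℤ) : Set where
  field
    before after  : Word
    split         : w ≡ before ++ ℓ ∷ after
    height-before : height h before ≡ t
    none-after    : coeffFrom ℓ (t ℤ.+ step ℓ) after t ≡ 0

lastStep : ∀ ℓ h w t → 1 ≤ coeffFrom ℓ h w t → LastStep ℓ h w t
lastStep ℓ h (c ∷ w) t pos with coeffFrom ℓ (h ℤ.+ step c) w t in eq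
... | suc _ = record
  { before = c ∷ before ; after = after ; split = cong (c ∷_) split
  ; height-before = height-before ; none-after = none-after }
  where open LastStep (lastStep ℓ (h ℤ.+ step c) w t (subst (1 ≤_) (sym eq) (s≤s z≤n)))
... | zero with δ-positive c h ℓ t (subst (1 ≤_) (trans (coeffFrom-∷ ℓ c h w t) (trans (cong (_+_ (δ c h ℓ t)) eq) (ℕP.+-identityʳ _))) pos)
...   | refl , refl = record { before = [] ; after = w ; split = refl ; height-before = refl ; none-after = eq }

record Prefix (h : ℤ) (w : Word) (t : ℤ) : Set where
  field
    init rest   : Word
    split       : w ≡ init ++ rest
    height-init : height h init ≡ t

prefix-descending : ∀ h w t → height h w ℤ.≤ t → t ℤ.≤ h → Prefix h w t
prefix-descending h w t end≤t t≤h with h ℤ.≟ t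
... | yes h≡t = record { init = [] ; rest = w ; split = refl ; height-init = h≡t }
prefix-descending h [] t end≤t t≤h | no h≢t = ⊥-elim (h≢t (ℤP.≤-antisym end≤t t≤h))
prefix-descending h (c ∷ w) t end≤t t≤h | no h≢t = record
  { init = c ∷ init ; rest = rest ; split = cong (c ∷_) split ; height-init = height-init }
  where
  t≤next : ∀ c → t ℤ.≤ h ℤ.+ step c
  t≤next U = ℤP.≤-trans t≤h (≤+1 h)
  t≤next D = <⇒≤-1 (ℤP.≤∧≢⇒< t≤h (h≢t ∘ sym))
  open Prefix (prefix-descending (h ℤ.+ step c) w t end≤t (t≤next c))

prefix-ascending : ∀ h w t → h ℤ.≤ t → t ℤ.≤ height h w → Prefix h w t
prefix-ascending h w t h≤t t≤end with h ℤ.≟ t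
... | yes h≡t = record { init = [] ; rest = w ; split = refl ; height-init = h≡t }
prefix-ascending h [] t h≤t t≤end | no h≢t = ⊥-elim (h≢t (ℤP.≤-antisym h≤t t≤end))
prefix-ascending h (c ∷ w) t h≤t t≤end | no h≢t = record
  { init = c ∷ init ; rest = rest ; split = cong (c ∷_) split ; height-init = height-init }
  where
  next≤t : ∀ c → h ℤ.+ step c ℤ.≤ t
  next≤t U = <⇒+1≤ (ℤP.≤∧≢⇒< h≤t h≢t)
  next≤t D = ℤP.≤-trans (-1≤ h) h≤t
  open Prefix (prefix-ascending (h ℤ.+ step c) w t (next≤t c) t≤end)

upStep-below-end : ∀ h w t → h ℤ.≤ t → t ℤ.< height h w → 1 ≤ coeffFrom U h w t
upStep-below-end h []      t h≤t t<h = ⊥-elim (ℤP.<-irrefl refl (ℤP.≤-<-trans h≤t t<h))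
upStep-below-end h (U ∷ w) t h≤t t<end with h ℤ.≟ t
... | yes _   = s≤s z≤n
... | no h≢t  = upStep-below-end (h ℤ.+ + 1) w t (<⇒+1≤ (ℤP.≤∧≢⇒< h≤t h≢t)) t<end
upStep-below-end h (D ∷ w) t h≤t t<end = upStep-below-end (h ℤ.+ -[1+ 0 ]) w t (ℤP.≤-trans (-1≤ h) h≤t) t<end

downStep-above-end : ∀ h w t → t ℤ.≤ h → height h w ℤ.< t → 1 ≤ coeffFrom D h w t
downStep-above-end h []      t t≤h h<t = ⊥-elim (ℤP.<-irrefl refl (ℤP.<-≤-trans h<t t≤h))
downStep-above-end h (D ∷ w) t t≤h end<t with h ℤ.≟ t
... | yes _   = s≤s z≤n
... | no h≢t  = downStep-above-end (h ℤ.+ -[1+ 0 ]) w t (<⇒≤-1 (ℤP.≤∧≢⇒< t≤h (h≢t ∘ sym))) end<t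
downStep-above-end h (U ∷ w) t t≤h end<t = downStep-above-end (h ℤ.+ + 1) w t (ℤP.≤-trans t≤h (≤+1 h)) end<t

upStep-below-downStep : ∀ h w t t′ → h ℤ.≤ t → t ℤ.< t′ → 1 ≤ coeffFrom D h w t′ → 1 ≤ coeffFrom U h w t
upStep-below-downStep h w t t′ h≤t t<t′ pos = subst (λ x → 1 ≤ coeffFrom U h x t) (sym split)
  (ℕP.≤-trans (upStep-below-end h before t h≤t (subst (t ℤ.<_) (sym height-before) t<t′))
              (coeffFrom-++-≤ U h before (D ∷ after) t))
  where open LastStep (lastStep D h w t′ pos)

downStep-above-upStep : ∀ h w t t′ → t ℤ.≤ h → t′ ℤ.< t → 1 ≤ coeffFrom U h w t′ → 1 ≤ coeffFrom D h w t
downStep-above-upStep h w t t′ t≤h t′<t pos = subst (λ x → 1 ≤ coeffFrom D h x t) (sym split)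
  (ℕP.≤-trans (downStep-above-end h before t t≤h (subst (ℤ._< t) (sym height-before) t′<t))
              (coeffFrom-++-≤ D h before (U ∷ after) t))
  where open LastStep (lastStep U h w t′ pos)

-- The last letter of a class

-- The condition, in terms of the final height e and the arrivals α, β at e, for a class to contain a
-- word ending in ℓ.
CanEndWith : Letter → ℤ → ℕ → ℕ → Set
CanEndWith U (+ zero)  α β = 1 ≤ α
CanEndWith U (+ suc _) α β = 2 ≤ α ⊎ (1 ≤ α × β ≡ 0)
CanEndWith U -[1+ _ ]  α β = 1 ≤ α
CanEndWith D (+ zero)  α β = 1 ≤ β
CanEndWith D (+ suc _) α β = 1 ≤ β
CanEndWith D -[1+ _ ]  α β = 2 ≤ β ⊎ (1 ≤ β × α ≡ 0)

canEndWith? : ∀ ℓ e α β → Dec (CanEndWith ℓ e α β)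
canEndWith? U (+ zero)  α β = 1 ℕ.≤? α
canEndWith? U (+ suc _) α β = (2 ℕ.≤? α) ⊎-dec ((1 ℕ.≤? α) ×-dec (β ℕ.≟ 0))
canEndWith? U -[1+ _ ]  α β = 1 ℕ.≤? α
canEndWith? D (+ zero)  α β = 1 ℕ.≤? β
canEndWith? D (+ suc _) α β = 1 ℕ.≤? β
canEndWith? D -[1+ _ ]  α β = (2 ℕ.≤? β) ⊎-dec ((1 ℕ.≤? β) ×-dec (α ℕ.≟ 0))

Endable : Letter → Word → Set
Endable ℓ w = let e = finalHeight w in CanEndWith ℓ e (profile w U e) (profile w D e)

endable? : ∀ ℓ w → Dec (Endable ℓ w)
endable? ℓ w = let e = finalHeight w in canEndWith? ℓ e (profile w U e) (profile w D e)

U-arrival-forced : ∀ w k → 1 ≤ profile w D (+ suc k) → 1 ≤ profile w U (+ suc k)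
U-arrival-forced w k = upStep-below-downStep (+ 0) w (+ k) (+ suc (suc k)) (ℤ.+≤+ z≤n) (ℤ.+<+ (s≤s (ℕP.n≤1+n k)))


D-arrival-forced : ∀ w k → 1 ≤ profile w U -[1+ k ] → 1 ≤ profile w D -[1+ k ]
D-arrival-forced w zero    = downStep-above-upStep (+ 0) w (+ 0) -[1+ 1 ] ℤP.≤-refl ℤ.-<+
D-arrival-forced w (suc k) = downStep-above-upStep (+ 0) w -[1+ k ] -[1+ suc (suc k) ] ℤ.-≤+ (ℤ.-<- (s≤s (ℕP.n≤1+n k)))

profile-snoc-own : ∀ v ℓ → let e = finalHeight (v ++ ℓ ∷ []) in profile (v ++ ℓ ∷ []) ℓ e ≡ suc (profile v ℓ e)
profile-snoc-own v ℓ = trans (profile-snoc v ℓ ℓ _) (trans (cong (_+_ (profile v ℓ _)) (δ-self ℓ _)) (ℕP.+-comm _ 1))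

snoc-Endable : ∀ v ℓ → Endable ℓ (v ++ ℓ ∷ [])
snoc-Endable v U = subst₂ (CanEndWith U e) (sym (profile-snoc-own v U)) (sym (trans (profile-snoc v U D e) (ℕP.+-identityʳ _))) (endable e)
  where
  e = finalHeight (v ++ U ∷ [])
  endable : ∀ e → CanEndWith U e (suc (profile v U e)) (profile v D e)
  endable (+ zero)  = s≤s z≤n
  endable -[1+ _ ]  = s≤s z≤n
  endable (+ suc k) with profile v U (+ suc k) in α≡ | profile v D (+ suc k) in β≡
  ... | suc _ | _     = inj₁ (s≤s (s≤s z≤n))
  ... | zero  | zero  = inj₂ (s≤s z≤n , refl)
  ... | zero  | suc _ = ⊥-elim (ℕP.n≮0 (subst (0 <_) α≡ (U-arrival-forced v k (subst (1 ≤_) (sym β≡) (s≤s z≤n)))))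
snoc-Endable v D = subst₂ (CanEndWith D e) (sym (trans (profile-snoc v D U e) (ℕP.+-identityʳ _))) (sym (profile-snoc-own v D)) (endable e)
  where
  e = finalHeight (v ++ D ∷ [])
  endable : ∀ e → CanEndWith D e (profile v U e) (suc (profile v D e))
  endable (+ zero)  = s≤s z≤n
  endable (+ suc _) = s≤s z≤n
  endable -[1+ k ] with profile v D -[1+ k ] in β≡ | profile v U -[1+ k ] in α≡
  ... | suc _ | _     = inj₁ (s≤s (s≤s z≤n))
  ... | zero  | zero  = inj₂ (s≤s z≤n , refl)
  ... | zero  | suc _ = ⊥-elim (ℕP.n≮0 (subst (0 <_) β≡ (D-arrival-forced v k (subst (1 ≤_) (sym α≡) (s≤s z≤n)))))

other : Letter → Letter
other U = D
other D = U

letter-cases : ∀ ℓ ℓ′ → ℓ′ ≡ ℓ ⊎ ℓ′ ≡ other ℓ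
letter-cases U U = inj₁ refl
letter-cases U D = inj₂ refl
letter-cases D U = inj₂ refl
letter-cases D D = inj₁ refl

length-snoc : ∀ v (c : Letter) → length (v ++ c ∷ []) ≡ suc (length v)
length-snoc v c = trans (LP.length-++ v) (ℕP.+-comm _ 1)

-- The last step of a nonempty loop arrives at its base height.
empty-loop : ∀ e y → height e y ≡ e → (∀ ℓ → coeffFrom ℓ e y (source ℓ e) ≡ 0) → y ≡ []
empty-loop e y loop none with initLast y
... | []      = refl
... | v ∷ʳ′ c = ⊥-elim (ℕP.n≮0 (subst (0 <_) (none c) (subst (1 ≤_) (sym arrivals) (ℕP.m≤n+m 1 _))))
  where
  height-v : height e v ≡ source c e
  height-v = trans (sym (source-step c _)) (cong (source c) (trans (sym (height-++ e v (c ∷ []))) loop))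
  arrivals : coeffFrom c e (v ++ c ∷ []) (source c e) ≡ coeffFrom c e v (source c e) + 1
  arrivals = trans (coeffFrom-snoc c e v c _) (cong (_+_ (coeffFrom c e v _)) (trans (cong (λ h → δ c h c _) height-v) (δ-self c _)))

loop-to-end : ∀ ℓ r s q → Balanced (s ++ ℓ ∷ []) → Balanced q → (r ++ s ++ ℓ ∷ q) ∼bal ((r ++ q ++ s) ++ ℓ ∷ [])
loop-to-end ℓ r s q bal-sℓ bal-q =
  ∼bal.sym (EqClosure.return (subst₂ BalComm moved original (comm r [] (s ++ ℓ ∷ []) q bal-sℓ bal-q)))
  where
  open ≡-Reasoning
  moved : r ++ q ++ (s ++ ℓ ∷ []) ++ [] ≡ (r ++ q ++ s) ++ ℓ ∷ []
  moved = begin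
    r ++ q ++ (s ++ ℓ ∷ []) ++ []   ≡⟨ cong (λ z → r ++ q ++ z) (LP.++-identityʳ _) ⟩
    r ++ q ++ s ++ ℓ ∷ []           ≡⟨ cong (r ++_) (LP.++-assoc q s _) ⟨
    r ++ (q ++ s) ++ ℓ ∷ []         ≡⟨ LP.++-assoc r _ _ ⟨
    (r ++ q ++ s) ++ ℓ ∷ []         ∎
  original : r ++ (s ++ ℓ ∷ []) ++ q ++ [] ≡ r ++ s ++ ℓ ∷ q
  original = cong (r ++_) (trans (LP.++-assoc s _ _) (cong (λ z → s ++ ℓ ∷ z) (LP.++-identityʳ q)))

-- Split w at its last ℓ-step arriving at the final height e: w = before ℓ after with after a loop at e.
-- If before passes through e, say before = init rest, the loop rest ℓ commutes past after;
-- if after is empty, w already ends in ℓ.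
module LastArrival (ℓ : Letter) (w : Word) {e : ℤ} (w↦e : finalHeight w ≡ e) (arrived : 1 ≤ profile w ℓ e) where

  open LastStep (lastStep ℓ (+ 0) w (source ℓ e) arrived) public

  Result : Set
  Result = Σ[ v ∈ Word ] w ∼bal (v ++ ℓ ∷ [])

  no-later-arrival : coeffFrom ℓ e after (source ℓ e) ≡ 0
  no-later-arrival = subst (λ h → coeffFrom ℓ h after (source ℓ e) ≡ 0) (step-source ℓ e) none-after

  w≡ : w ≡ (before ++ ℓ ∷ []) ++ after
  w≡ = trans split (sym (LP.++-assoc before (ℓ ∷ []) after))

  height-before-ℓ : finalHeight (before ++ ℓ ∷ []) ≡ e
  height-before-ℓ = trans (height-++ (+ 0) before (ℓ ∷ [])) (trans (cong (ℤ._+ step ℓ) height-before) (step-source ℓ e))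

  after-loop : height e after ≡ e
  after-loop = begin
    height e after                                          ≡⟨ cong (λ h → height h after) height-before-ℓ ⟨
    height (finalHeight (before ++ ℓ ∷ [])) after           ≡⟨ height-++ (+ 0) (before ++ ℓ ∷ []) after ⟨
    finalHeight ((before ++ ℓ ∷ []) ++ after)               ≡⟨ cong finalHeight w≡ ⟨
    finalHeight w                                           ≡⟨ w↦e ⟩
    e                                                       ∎
    where open ≡-Reasoning

  profile-split : ∀ ℓ′ →
    profile w ℓ′ e ≡ coeffFrom ℓ′ (+ 0) (before ++ ℓ ∷ []) (source ℓ′ e) + coeffFrom ℓ′ e after (source ℓ′ e)
  profile-split ℓ′ = trans (cong (λ x → coeffFrom ℓ′ (+ 0) x _) w≡)
    (trans (coeffFrom-++ ℓ′ (+ 0) (before ++ ℓ ∷ []) after _)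
           (cong (λ h → coeffFrom ℓ′ (+ 0) (before ++ ℓ ∷ []) (source ℓ′ e) + coeffFrom ℓ′ h after (source ℓ′ e)) height-before-ℓ))

  move-loop : Prefix (+ 0) before e → Result
  move-loop p = init ++ after ++ rest ,
    subst (_∼bal ((init ++ after ++ rest) ++ ℓ ∷ [])) (sym w≡′) (loop-to-end ℓ init rest after loop-Balanced after-Balanced)
    where
    open Prefix p renaming (split to before≡)
    w≡′ : w ≡ init ++ rest ++ ℓ ∷ after
    w≡′ = trans split (trans (cong (_++ ℓ ∷ after) before≡) (LP.++-assoc init rest _))
    loop-Balanced : Balanced (rest ++ ℓ ∷ [])
    loop-Balanced = height≡⇒Balanced e (rest ++ ℓ ∷ []) (begin
      height e (rest ++ ℓ ∷ [])                       ≡⟨ cong (λ h → height h (rest ++ ℓ ∷ [])) height-init ⟨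
      height (finalHeight init) (rest ++ ℓ ∷ [])      ≡⟨ height-++ (+ 0) init _ ⟨
      finalHeight (init ++ rest ++ ℓ ∷ [])            ≡⟨ cong finalHeight (LP.++-assoc init rest _) ⟨
      finalHeight ((init ++ rest) ++ ℓ ∷ [])          ≡⟨ cong (λ x → finalHeight (x ++ ℓ ∷ [])) before≡ ⟨
      finalHeight (before ++ ℓ ∷ [])                  ≡⟨ height-before-ℓ ⟩
      e                                               ∎)
      where open ≡-Reasoning
    after-Balanced : Balanced after
    after-Balanced = height≡⇒Balanced e after after-loop

  earlier-arrival : 2 ≤ profile w ℓ e → Result
  earlier-arrival two = move-loop (record
    { init = before′ ++ ℓ ∷ [] ; rest = after′
    ; split = trans split′ (sym (LP.++-assoc before′ (ℓ ∷ []) after′))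
    ; height-init = trans (height-++ (+ 0) before′ (ℓ ∷ [])) (trans (cong (ℤ._+ step ℓ) height-before′) (step-source ℓ e)) })
    where
    t = source ℓ e
    c = coeffFrom ℓ (+ 0) before t
    profile≡ : profile w ℓ e ≡ c + 1
    profile≡ = begin
      profile w ℓ e                                                 ≡⟨ profile-split ℓ ⟩
      coeffFrom ℓ (+ 0) (before ++ ℓ ∷ []) t + coeffFrom ℓ e after t ≡⟨ cong₂ _+_ (coeffFrom-snoc ℓ (+ 0) before ℓ t) no-later-arrival ⟩
      c + δ ℓ (finalHeight before) ℓ t + 0                          ≡⟨ ℕP.+-identityʳ _ ⟩
      c + δ ℓ (finalHeight before) ℓ t                              ≡⟨ cong (λ h → c + δ ℓ h ℓ t) height-before ⟩
      c + δ ℓ t ℓ t                                                 ≡⟨ cong (_+_ c) (δ-self ℓ t) ⟩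
      c + 1                                                         ∎
      where open ≡-Reasoning
    open LastStep (lastStep ℓ (+ 0) before (source ℓ e) (ℕP.≤-pred (subst (2 ≤_) (trans profile≡ (ℕP.+-comm _ 1)) two)))
      renaming (before to before′; after to after′; split to split′; height-before to height-before′)

  no-other-arrival : profile w (other ℓ) e ≡ 0 → Result
  no-other-arrival none-other = before ,
    subst (λ y → w ∼bal (before ++ ℓ ∷ y)) (empty-loop e after after-loop none) (subst (w ∼bal_) split ∼bal.refl)
    where
    none : ∀ ℓ′ → coeffFrom ℓ′ e after (source ℓ′ e) ≡ 0
    none ℓ′ with letter-cases ℓ ℓ′
    ... | inj₁ refl = no-later-arrival
    ... | inj₂ refl = ℕP.n≤0⇒n≡0 (subst (coeffFrom (other ℓ) e after (source (other ℓ) e) ≤_)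
            (trans (sym (profile-split (other ℓ))) none-other) (ℕP.m≤n+m _ _))

Endable⇒∼snoc : ∀ ℓ w → Endable ℓ w → Σ[ v ∈ Word ] w ∼bal (v ++ ℓ ∷ [])
Endable⇒∼snoc U w = from-height (finalHeight w) refl
  where
  from-height : ∀ e → finalHeight w ≡ e → CanEndWith U e (profile w U e) (profile w D e) → Σ[ v ∈ Word ] w ∼bal (v ++ U ∷ [])
  from-height (+ zero) w↦e c = move-loop (record { init = [] ; rest = before ; split = refl ; height-init = refl })
    where open LastArrival U w w↦e c
  from-height (+ suc k) w↦e (inj₁ two) = earlier-arrival two
    where open LastArrival U w w↦e (ℕP.≤-trans (s≤s z≤n) two)
  from-height (+ suc k) w↦e (inj₂ (one , none)) = no-other-arrival none
    where open LastArrival U w w↦e one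
  from-height -[1+ k ] w↦e c =
    move-loop (prefix-descending (+ 0) before -[1+ k ] (ℤP.≤-trans (ℤP.≤-reflexive height-before) (ℤ.-≤- (ℕP.n≤1+n k))) ℤ.-≤+)
    where open LastArrival U w w↦e c
Endable⇒∼snoc D w = from-height (finalHeight w) refl
  where
  from-height : ∀ e → finalHeight w ≡ e → CanEndWith D e (profile w U e) (profile w D e) → Σ[ v ∈ Word ] w ∼bal (v ++ D ∷ [])
  from-height (+ zero) w↦e c = move-loop (record { init = [] ; rest = before ; split = refl ; height-init = refl })
    where open LastArrival D w w↦e c
  from-height -[1+ k ] w↦e (inj₁ two) = earlier-arrival two
    where open LastArrival D w w↦e (ℕP.≤-trans (s≤s z≤n) two)
  from-height -[1+ k ] w↦e (inj₂ (one , none)) = no-other-arrival none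
    where open LastArrival D w w↦e one
  from-height (+ suc k) w↦e c =
    move-loop (prefix-ascending (+ 0) before (+ suc k) (ℤ.+≤+ z≤n)
                (ℤP.≤-trans (ℤ.+≤+ (ℕP.n≤1+n (suc k))) (ℤP.≤-reflexive (sym height-before))))
    where open LastArrival D w w↦e c

Invariants⇒Endable : ∀ ℓ {u w} → Invariants u w → Endable ℓ u → Endable ℓ w
Invariants⇒Endable ℓ {u} {w} inv c =
  subst₂ (CanEndWith ℓ (finalHeight w)) (coeff≡ U _) (coeff≡ D _)
    (subst (λ e → CanEndWith ℓ e (profile u U e) (profile u D e)) height≡ c)
  where open Invariants inv

Invariants-snoc-cancel : ∀ ℓ v w → Invariants (v ++ ℓ ∷ []) (w ++ ℓ ∷ []) → Invariants v w
Invariants-snoc-cancel ℓ v w inv = record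
  { coeff≡  = λ ℓ′ t → ℕP.+-cancelʳ-≡ _ _ _ (begin
      coeffFrom ℓ′ (+ 0) v t + δ ℓ (finalHeight v) ℓ′ t        ≡⟨ coeffFrom-snoc ℓ′ (+ 0) v ℓ t ⟨
      coeffFrom ℓ′ (+ 0) (v ++ ℓ ∷ []) t                         ≡⟨ coeff≡ ℓ′ t ⟩
      coeffFrom ℓ′ (+ 0) (w ++ ℓ ∷ []) t                         ≡⟨ coeffFrom-snoc ℓ′ (+ 0) w ℓ t ⟩
      coeffFrom ℓ′ (+ 0) w t + δ ℓ (finalHeight w) ℓ′ t        ≡⟨ cong (λ h → coeffFrom ℓ′ (+ 0) w t + δ ℓ h ℓ′ t) heights ⟨
      coeffFrom ℓ′ (+ 0) w t + δ ℓ (finalHeight v) ℓ′ t        ∎)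
  ; height≡ = heights
  ; length≡ = ℕP.suc-injective (trans (sym (length-snoc v ℓ)) (trans length≡ (length-snoc w ℓ)))
  }
  where
  open Invariants inv
  open ≡-Reasoning
  heights : finalHeight v ≡ finalHeight w
  heights = begin
    finalHeight v                              ≡⟨ source-step ℓ _ ⟨
    source ℓ (finalHeight v ℤ.+ step ℓ)        ≡⟨ cong (source ℓ) (height-++ (+ 0) v (ℓ ∷ [])) ⟨
    source ℓ (finalHeight (v ++ ℓ ∷ []))       ≡⟨ cong (source ℓ) height≡ ⟩
    source ℓ (finalHeight (w ++ ℓ ∷ []))       ≡⟨ cong (source ℓ) (height-++ (+ 0) w (ℓ ∷ [])) ⟩
    source ℓ (finalHeight w ℤ.+ step ℓ)        ≡⟨ source-step ℓ _ ⟩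
    finalHeight w                              ∎

Invariants⇒∼bal : ∀ {u w} → Invariants u w → u ∼bal w
Invariants⇒∼bal {u} = by-length (length u) refl
  where
  by-length : ∀ n {u w} → length u ≡ n → Invariants u w → u ∼bal w
  by-length n {u} {w} u↦n inv with initLast u | initLast w
  ... | []      | []      = ∼bal.refl
  ... | []      | v ∷ʳ′ c = ⊥-elim (ℕP.1+n≢0 (trans (sym (length-snoc v c)) (sym (Invariants.length≡ inv))))
  ... | v ∷ʳ′ ℓ | _ with n
  ...   | zero  = ⊥-elim (ℕP.1+n≢0 (trans (sym (length-snoc v ℓ)) u↦n))
  ...   | suc m = ∼bal.trans (∼bal-snoc (ℓ ∷ []) v∼w′) (∼bal.sym w∼w′ℓ)
    where
    w′∼ = Endable⇒∼snoc ℓ w (Invariants⇒Endable ℓ inv (snoc-Endable v ℓ))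
    w′ = proj₁ w′∼
    w∼w′ℓ = proj₂ w′∼
    v∼w′ : v ∼bal w′
    v∼w′ = by-length m (ℕP.suc-injective (trans (sym (length-snoc v ℓ)) u↦n))
             (Invariants-snoc-cancel ℓ v w′ (IsEquivalence.trans Invariants-isEquivalence inv (∼bal⇒Invariants w∼w′ℓ)))

∼bal-snoc-cancel : ∀ ℓ {v w} → (v ++ ℓ ∷ []) ∼bal (w ++ ℓ ∷ []) → v ∼bal w
∼bal-snoc-cancel ℓ {v} {w} = Invariants⇒∼bal ∘ Invariants-snoc-cancel ℓ v w ∘ ∼bal⇒Invariants

-- The formula as a product over levels

Reachable : ℤ → ℕ → ℕ → Set
Reachable (+ zero)  α β = 1 ≤ α ⊎ 1 ≤ β
Reachable (+ suc _) α β = 1 ≤ α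
Reachable -[1+ _ ]  α β = 1 ≤ β

-- The factor of the theorem's formula at height e, in terms of (α_e, β_e): the i-th factor of
-- infProduct is the product of the factors at ±(i+1), and caseFactor is the factor at 0.
levelFactor : ℤ → ℕ → ℕ → ℕ
levelFactor (+ zero)  α β = (α + β) C α
levelFactor (+ suc _) α β = binom-1 α β β
levelFactor -[1+ _ ]  α β = binom-1 β α α

positiveLevel-pascal : ∀ k α β → 1 ≤ α →
  binom-1 α β β ≡ ind (canEndWith? U (+ suc k) α β) * binom-1 (α ∸ 1) β β + ind (canEndWith? D (+ suc k) α β) * binom-1 α (β ∸ 1) (β ∸ 1)
positiveLevel-pascal k (suc zero)    zero    _ = refl
positiveLevel-pascal k (suc zero)    (suc b) _ = trans (nCn≡1 (suc b)) (sym (trans (ℕP.+-identityʳ _) (nCn≡1 b)))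
positiveLevel-pascal k (suc (suc a)) zero    _ = refl
positiveLevel-pascal k (suc (suc a)) (suc b) _ = begin
  suc (a + suc b) C suc b                                            ≡⟨ nCk+nC[k+1]≡[n+1]C[k+1] (a + suc b) b ⟨
  (a + suc b) C b + (a + suc b) C suc b                              ≡⟨ cong (λ n → n C b + (a + suc b) C suc b) (ℕP.+-suc a b) ⟩
  suc (a + b) C b + (a + suc b) C suc b                              ≡⟨ ℕP.+-comm (suc (a + b) C b) ((a + suc b) C suc b) ⟩
  (a + suc b) C suc b + suc (a + b) C b
    ≡⟨ cong₂ _+_ (ℕP.*-identityˡ ((a + suc b) C suc b)) (ℕP.*-identityˡ (suc (a + b) C b)) ⟨
  1 * binom-1 (suc a) (suc b) (suc b) + 1 * binom-1 (suc (suc a)) b b ∎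
  where open ≡-Reasoning

zeroLevel-pascal : ∀ α β → Reachable (+ 0) α β →
  (α + β) C α ≡ ind (canEndWith? U (+ 0) α β) * ((α ∸ 1 + β) C (α ∸ 1)) + ind (canEndWith? D (+ 0) α β) * ((α + (β ∸ 1)) C α)
zeroLevel-pascal zero    zero    (inj₁ ())
zeroLevel-pascal zero    zero    (inj₂ ())
zeroLevel-pascal zero    (suc b) _ = refl
zeroLevel-pascal (suc a) zero    _ = begin
  suc (a + 0) C suc a         ≡⟨ cong (λ n → n C suc a) (ℕP.+-identityʳ (suc a)) ⟩
  suc a C suc a               ≡⟨ trans (nCn≡1 (suc a)) (sym (nCn≡1 a)) ⟩
  a C a                       ≡⟨ cong (_C a) (ℕP.+-identityʳ a) ⟨
  (a + 0) C a                 ≡⟨ trans (ℕP.+-identityʳ (1 * ((a + 0) C a))) (ℕP.*-identityˡ ((a + 0) C a)) ⟨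
  1 * ((a + 0) C a) + 0       ∎
  where open ≡-Reasoning
zeroLevel-pascal (suc a) (suc b) _ = begin
  suc (a + suc b) C suc a                                  ≡⟨ nCk+nC[k+1]≡[n+1]C[k+1] (a + suc b) a ⟨
  (a + suc b) C a + (a + suc b) C suc a                    ≡⟨ cong (λ n → (a + suc b) C a + n C suc a) (ℕP.+-suc a b) ⟩
  (a + suc b) C a + suc (a + b) C suc a
    ≡⟨ cong₂ _+_ (ℕP.*-identityˡ ((a + suc b) C a)) (ℕP.*-identityˡ (suc (a + b) C suc a)) ⟨
  1 * ((a + suc b) C a) + 1 * (suc (a + b) C suc a)        ∎
  where open ≡-Reasoning

levelFactor-pascal : ∀ e α β → Reachable e α β →
  levelFactor e α β ≡ ind (canEndWith? U e α β) * levelFactor e (α ∸ 1) β + ind (canEndWith? D e α β) * levelFactor e α (β ∸ 1)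
levelFactor-pascal (+ zero)  α β r = zeroLevel-pascal α β r
levelFactor-pascal (+ suc k) α β r = positiveLevel-pascal k α β r
levelFactor-pascal -[1+ k ]  α β r = trans (positiveLevel-pascal k β α r)
  (ℕP.+-comm (ind (canEndWith? D -[1+ k ] α β) * binom-1 (β ∸ 1) α α) (ind (canEndWith? U -[1+ k ] α β) * binom-1 β (α ∸ 1) (α ∸ 1)))

∏< : ℕ → (ℕ → ℕ) → ℕ
∏< n f = product (map f (upTo n))

∏<-suc : ∀ n f → ∏< (suc n) f ≡ ∏< n f * f n
∏<-suc n f = begin
  product (map f (upTo (suc n)))                ≡⟨ cong (λ is → product (map f is)) (LP.upTo-∷ʳ n) ⟨
  product (map f (upTo n ++ n ∷ []))            ≡⟨ cong product (LP.map-++ f (upTo n) (n ∷ [])) ⟩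
  product (map f (upTo n) ++ f n ∷ [])          ≡⟨ product-++ (map f (upTo n)) (f n ∷ []) ⟩
  ∏< n f * (f n * 1)                            ≡⟨ cong (_*_ (∏< n f)) (ℕP.*-identityʳ (f n)) ⟩
  ∏< n f * f n                                  ∎
  where open ≡-Reasoning

∏<-cong : ∀ n {f g} → (∀ i → i < n → f i ≡ g i) → ∏< n f ≡ ∏< n g
∏<-cong zero    f≗g = refl
∏<-cong (suc n) {f} {g} f≗g = begin
  ∏< (suc n) f      ≡⟨ ∏<-suc n f ⟩
  ∏< n f * f n      ≡⟨ cong₂ _*_ (∏<-cong n (λ i i<n → f≗g i (ℕP.m<n⇒m<1+n i<n))) (f≗g n ℕP.≤-refl) ⟩
  ∏< n g * g n      ≡⟨ ∏<-suc n g ⟨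
  ∏< (suc n) g      ∎
  where open ≡-Reasoning

*-distribˡ-linear : ∀ p x a y b → p * (x * a + y * b) ≡ x * (p * a) + y * (p * b)
*-distribˡ-linear = solve-∀

*-distribʳ-linear : ∀ x a y b p → (x * a + y * b) * p ≡ x * (a * p) + y * (b * p)
*-distribʳ-linear = solve-∀

∏<-linear : ∀ n {j f g h} x y → j < n → (∀ i → i ≢ j → f i ≡ g i) → (∀ i → i ≢ j → f i ≡ h i) →
  f j ≡ x * g j + y * h j → ∏< n f ≡ x * ∏< n g + y * ∏< n h
∏<-linear (suc n) {j} {f} {g} {h} x y j<1+n f≗g f≗h fj with j ℕ.≟ n
... | yes refl = begin
  ∏< (suc j) f                                        ≡⟨ ∏<-suc j f ⟩
  ∏< j f * f j                                        ≡⟨ cong (_*_ (∏< j f)) fj ⟩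
  ∏< j f * (x * g j + y * h j)                        ≡⟨ *-distribˡ-linear (∏< j f) x (g j) y (h j) ⟩
  x * (∏< j f * g j) + y * (∏< j f * h j)             ≡⟨ cong₂ (λ p q → x * (p * g j) + y * (q * h j)) (below f≗g) (below f≗h) ⟩
  x * (∏< j g * g j) + y * (∏< j h * h j)             ≡⟨ cong₂ (λ p q → x * p + y * q) (∏<-suc j g) (∏<-suc j h) ⟨
  x * ∏< (suc j) g + y * ∏< (suc j) h                 ∎
  where
  open ≡-Reasoning
  below : ∀ {k} → (∀ i → i ≢ j → f i ≡ k i) → ∏< j f ≡ ∏< j k
  below f≗k = ∏<-cong j (λ i i<j → f≗k i (ℕP.<⇒≢ i<j))
... | no j≢n = begin
  ∏< (suc n) f                                        ≡⟨ ∏<-suc n f ⟩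
  ∏< n f * f n                                        ≡⟨ cong (_* f n) (∏<-linear n x y j<n f≗g f≗h fj) ⟩
  (x * ∏< n g + y * ∏< n h) * f n                     ≡⟨ *-distribʳ-linear x (∏< n g) y (∏< n h) (f n) ⟩
  x * (∏< n g * f n) + y * (∏< n h * f n)
    ≡⟨ cong₂ (λ p q → x * (∏< n g * p) + y * (∏< n h * q)) (f≗g n (j≢n ∘ sym)) (f≗h n (j≢n ∘ sym)) ⟩
  x * (∏< n g * g n) + y * (∏< n h * h n)             ≡⟨ cong₂ (λ p q → x * p + y * q) (∏<-suc n g) (∏<-suc n h) ⟨
  x * ∏< (suc n) g + y * ∏< (suc n) h                 ∎
  where
  open ≡-Reasoning
  j<n : j < n
  j<n = ℕP.≤∧≢⇒< (ℕP.≤-pred j<1+n) j≢n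

levelPair : (ℤ → ℕ) → ℕ → ℕ
levelPair T i = T (+ suc i) * T -[1+ i ]

levelProduct : ℕ → (ℤ → ℕ) → ℕ
levelProduct R T = ∏< R (levelPair T) * T (+ 0)

levelProduct-linear-from-pairs : ∀ R {T T₁ T₂ : ℤ → ℕ} x y →
  ∏< R (levelPair T) ≡ x * ∏< R (levelPair T₁) + y * ∏< R (levelPair T₂) → T (+ 0) ≡ T₁ (+ 0) → T (+ 0) ≡ T₂ (+ 0) →
  levelProduct R T ≡ x * levelProduct R T₁ + y * levelProduct R T₂
levelProduct-linear-from-pairs R {T} {T₁} {T₂} x y pairs T₀ T₀′ =
  trans (cong (_* T (+ 0)) pairs) (trans (*-distribʳ-linear x _ y _ (T (+ 0)))
    (cong₂ (λ p q → x * (∏< R (levelPair T₁) * p) + y * (∏< R (levelPair T₂) * q)) T₀ T₀′))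

levelProduct-linear : ∀ R e {T T₁ T₂} x y → ℤ.∣ e ∣ ≤ R →
  (∀ t → t ≢ e → T t ≡ T₁ t) → (∀ t → t ≢ e → T t ≡ T₂ t) → T e ≡ x * T₁ e + y * T₂ e →
  levelProduct R T ≡ x * levelProduct R T₁ + y * levelProduct R T₂
levelProduct-linear R (+ zero) {T} {T₁} {T₂} x y _ T≗T₁ T≗T₂ Te = begin
  ∏< R (levelPair T) * T (+ 0)                       ≡⟨ cong (_*_ (∏< R (levelPair T))) Te ⟩
  ∏< R (levelPair T) * (x * T₁ (+ 0) + y * T₂ (+ 0))  ≡⟨ *-distribˡ-linear (∏< R (levelPair T)) x _ y _ ⟩
  x * (∏< R (levelPair T) * T₁ (+ 0)) + y * (∏< R (levelPair T) * T₂ (+ 0))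
    ≡⟨ cong₂ (λ p q → x * (p * T₁ (+ 0)) + y * (q * T₂ (+ 0))) (pairs-cong T≗T₁) (pairs-cong T≗T₂) ⟩
  x * levelProduct R T₁ + y * levelProduct R T₂      ∎
  where
  open ≡-Reasoning
  pairs-cong : ∀ {T′} → (∀ t → t ≢ + 0 → T t ≡ T′ t) → ∏< R (levelPair T) ≡ ∏< R (levelPair T′)
  pairs-cong T≗T′ = ∏<-cong R (λ i _ → cong₂ _*_ (T≗T′ (+ suc i) λ ()) (T≗T′ -[1+ i ] λ ()))
levelProduct-linear R (+ suc j) {T} {T₁} {T₂} x y j<R T≗T₁ T≗T₂ Te =
  levelProduct-linear-from-pairs R {T} {T₁} {T₂} x y (∏<-linear R x y j<R (pair-cong T≗T₁) (pair-cong T≗T₂) pair-j)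
    (T≗T₁ (+ 0) λ ()) (T≗T₂ (+ 0) λ ())
  where
  pair-cong : ∀ {T′} → (∀ t → t ≢ + suc j → T t ≡ T′ t) → ∀ i → i ≢ j → levelPair T i ≡ levelPair T′ i
  pair-cong T≗T′ i i≢j = cong₂ _*_ (T≗T′ (+ suc i) (i≢j ∘ ℕP.suc-injective ∘ ℤP.+-injective)) (T≗T′ -[1+ i ] λ ())
  pair-j : levelPair T j ≡ x * levelPair T₁ j + y * levelPair T₂ j
  pair-j = trans (cong (_* T -[1+ j ]) Te) (trans (*-distribʳ-linear x _ y _ (T -[1+ j ]))
             (cong₂ (λ p q → x * (T₁ (+ suc j) * p) + y * (T₂ (+ suc j) * q)) (T≗T₁ -[1+ j ] λ ()) (T≗T₂ -[1+ j ] λ ())))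
levelProduct-linear R -[1+ j ] {T} {T₁} {T₂} x y j<R T≗T₁ T≗T₂ Te =
  levelProduct-linear-from-pairs R {T} {T₁} {T₂} x y (∏<-linear R x y j<R (pair-cong T≗T₁) (pair-cong T≗T₂) pair-j)
    (T≗T₁ (+ 0) λ ()) (T≗T₂ (+ 0) λ ())
  where
  pair-cong : ∀ {T′} → (∀ t → t ≢ -[1+ j ] → T t ≡ T′ t) → ∀ i → i ≢ j → levelPair T i ≡ levelPair T′ i
  pair-cong T≗T′ i i≢j = cong₂ _*_ (T≗T′ (+ suc i) λ ()) (T≗T′ -[1+ i ] (i≢j ∘ ℤP.-[1+-injective))
  pair-j : levelPair T j ≡ x * levelPair T₁ j + y * levelPair T₂ j
  pair-j = trans (cong (_*_ (T (+ suc j))) Te) (trans (*-distribˡ-linear (T (+ suc j)) x _ y _)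
             (cong₂ (λ p q → x * (p * T₁ -[1+ j ]) + y * (q * T₂ -[1+ j ])) (T≗T₁ (+ suc j) λ ()) (T≗T₂ (+ suc j) λ ())))

levelProduct-cong : ∀ R {T T′ : ℤ → ℕ} → (∀ t → T t ≡ T′ t) → levelProduct R T ≡ levelProduct R T′
levelProduct-cong R T≗T′ = cong₂ _*_ (∏<-cong R (λ i _ → cong₂ _*_ (T≗T′ _) (T≗T′ _))) (T≗T′ (+ 0))

levelTerm : Profile → ℤ → ℕ
levelTerm N e = levelFactor e (N U e) (N D e)

formula : ℕ → Profile → ℕ
formula R N = levelProduct R (levelTerm N)

formula-cong : ∀ R {N M : Profile} → (∀ ℓ t → N ℓ t ≡ M ℓ t) → formula R N ≡ formula R M
formula-cong R N≗M = levelProduct-cong R (λ t → cong₂ (levelFactor t) (N≗M U t) (N≗M D t))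

lower : Letter → ℤ → Profile → Profile
lower ℓ e N ℓ′ t = N ℓ′ t ∸ δ ℓ e ℓ′ t

formula-pascal : ∀ R N e → ℤ.∣ e ∣ ≤ R → Reachable e (N U e) (N D e) →
  formula R N ≡ ind (canEndWith? U e (N U e) (N D e)) * formula R (lower U e N)
              + ind (canEndWith? D e (N U e) (N D e)) * formula R (lower D e N)
formula-pascal R N e e≤R reachable =
  levelProduct-linear R e (ind (canEndWith? U e (N U e) (N D e))) (ind (canEndWith? D e (N U e) (N D e))) e≤R (unchanged U) (unchanged D)
  (trans (levelFactor-pascal e (N U e) (N D e) reachable)
         (cong₂ (λ p q → ind (canEndWith? U e (N U e) (N D e)) * levelFactor e (N U e ∸ p) (N D e)
                       + ind (canEndWith? D e (N U e) (N D e)) * levelFactor e (N U e) (N D e ∸ q))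
                (sym (δ-self U e)) (sym (δ-self D e))))
  where
  unchanged : ∀ ℓ t → t ≢ e → levelTerm N t ≡ levelTerm (lower ℓ e N) t
  unchanged ℓ t t≢e =
    cong₂ (levelFactor t) (sym (cong (N U t ∸_) (δ-≢ ℓ U (t≢e ∘ sym)))) (sym (cong (N D t ∸_) (δ-≢ ℓ D (t≢e ∘ sym))))

-- Counting classes

HasCard-cong : ∀ {P Q : Word → Set} {n} → (∀ u → P u ⇔ Q u) → HasCard P n → HasCard Q n
HasCard-cong P⇔Q (us , unique , us⇔P , length≡) =
  us , unique ,
  (λ u → mk⇔ (Equivalence.to (P⇔Q u) ∘ Equivalence.to (us⇔P u)) (Equivalence.from (us⇔P u) ∘ Equivalence.from (P⇔Q u))) ,
  length≡

HasCard-∅ : ∀ {P : Word → Set} → (∀ u → ¬ P u) → HasCard P 0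
HasCard-∅ ¬P = [] , [] , (λ u → mk⇔ (λ ()) (⊥-elim ∘ ¬P u)) , refl

HasCard-image : ∀ {P : Word → Set} {n} (f : Word → Word) → (∀ {x y} → f x ≡ f y → x ≡ y) →
  HasCard P n → HasCard (λ u → Σ[ v ∈ Word ] P v × u ≡ f v) n
HasCard-image {P} f f-injective (us , unique , us⇔P , length≡) =
  map f us , Unique.map⁺ f-injective unique , members , trans (LP.length-map f us) length≡
  where
  members : ∀ u → (u ∈ map f us) ⇔ (Σ[ v ∈ Word ] P v × u ≡ f v)
  members u = mk⇔ to (λ { (v , Pv , refl) → ∈-map⁺ f (Equivalence.from (us⇔P v) Pv) })
    where
    to : u ∈ map f us → Σ[ v ∈ Word ] P v × u ≡ f v
    to u∈ with ∈-map⁻ f u∈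
    ... | v , v∈ , u≡ = v , Equivalence.to (us⇔P v) v∈ , u≡

HasCard-⊎ : ∀ {P Q : Word → Set} {m n} → (∀ u → P u → Q u → ⊥) → HasCard P m → HasCard Q n → HasCard (λ u → P u ⊎ Q u) (m + n)
HasCard-⊎ {P} {Q} disjoint (us , unique-us , us⇔P , length-us) (vs , unique-vs , vs⇔Q , length-vs) =
  us ++ vs , Unique.++⁺ unique-us unique-vs (λ (∈us , ∈vs) → disjoint _ (Equivalence.to (us⇔P _) ∈us) (Equivalence.to (vs⇔Q _) ∈vs)) ,
  members , trans (LP.length-++ us) (cong₂ _+_ length-us length-vs)
  where
  members : ∀ u → (u ∈ us ++ vs) ⇔ (P u ⊎ Q u)
  members u = mk⇔
    (λ u∈ → ⊎-map (Equivalence.to (us⇔P u)) (Equivalence.to (vs⇔Q u)) (∈-++⁻ us u∈))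
    [ ∈-++⁺ˡ ∘ Equivalence.from (us⇔P u) , ∈-++⁺ʳ us ∘ Equivalence.from (vs⇔Q u) ]

∣height∣≤ : ∀ h w → ℤ.∣ height h w ∣ ≤ ℤ.∣ h ∣ + length w
∣height∣≤ h []      = ℕP.m≤m+n ℤ.∣ h ∣ 0
∣height∣≤ h (c ∷ w) = begin
  ℤ.∣ height (h ℤ.+ step c) w ∣          ≤⟨ ∣height∣≤ (h ℤ.+ step c) w ⟩
  ℤ.∣ h ℤ.+ step c ∣ + length w          ≤⟨ ℕP.+-monoˡ-≤ (length w) (ℤP.∣i+j∣≤∣i∣+∣j∣ h (step c)) ⟩
  ℤ.∣ h ∣ + ℤ.∣ step c ∣ + length w      ≡⟨ ℕP.+-assoc ℤ.∣ h ∣ ℤ.∣ step c ∣ (length w) ⟩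
  ℤ.∣ h ∣ + (ℤ.∣ step c ∣ + length w)    ≡⟨ cong (λ s → ℤ.∣ h ∣ + (s + length w)) (∣step∣ c) ⟩
  ℤ.∣ h ∣ + suc (length w)               ∎
  where
  open ℕP.≤-Reasoning
  ∣step∣ : ∀ c → ℤ.∣ step c ∣ ≡ 1
  ∣step∣ U = refl
  ∣step∣ D = refl

snoc-Reachable : ∀ v ℓ → let w = v ++ ℓ ∷ [] ; e = finalHeight w in Reachable e (profile w U e) (profile w D e)
snoc-Reachable v ℓ = from-height (finalHeight (v ++ ℓ ∷ [])) refl
  where
  w = v ++ ℓ ∷ []
  arrival-at-0 : ∀ ℓ′ → 1 ≤ profile w ℓ′ (+ 0) → Reachable (+ 0) (profile w U (+ 0)) (profile w D (+ 0))
  arrival-at-0 U = inj₁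
  arrival-at-0 D = inj₂
  from-height : ∀ e → finalHeight w ≡ e → Reachable e (profile w U e) (profile w D e)
  from-height (+ zero) w↦0 =
    arrival-at-0 ℓ (subst (λ e → 1 ≤ profile w ℓ e) w↦0 (subst (1 ≤_) (sym (profile-snoc-own v ℓ)) (s≤s z≤n)))
  from-height (+ suc k) w↦e =
    upStep-below-end (+ 0) w (+ k) (ℤ.+≤+ z≤n) (subst (+ k ℤ.<_) (sym w↦e) (ℤ.+<+ ℕP.≤-refl))
  from-height -[1+ k ] w↦e =
    downStep-above-end (+ 0) w (ℤ.suc -[1+ k ]) (ℤP.i<j⇒suc[i]≤j (ℤ.-<+ {k} {0}))
      (subst (ℤ._< ℤ.suc -[1+ k ]) (sym w↦e) (ℤP.suc[i]≤j⇒i<j ℤP.≤-refl))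

EndsWith : Letter → Word → Set
EndsWith ℓ u = Σ[ v ∈ Word ] u ≡ v ++ ℓ ∷ []

lower-profile : ∀ ℓ w w′ → w ∼bal (w′ ++ ℓ ∷ []) → ∀ ℓ′ t → lower ℓ (finalHeight w) (profile w) ℓ′ t ≡ profile w′ ℓ′ t
lower-profile ℓ w w′ w∼w′ℓ ℓ′ t = begin
  profile w ℓ′ t ∸ δ ℓ (finalHeight w) ℓ′ t
    ≡⟨ cong₂ (λ p h → p ∸ δ ℓ h ℓ′ t) (coeff≡ ℓ′ (source ℓ′ t)) height≡ ⟩
  profile (w′ ++ ℓ ∷ []) ℓ′ t ∸ δ ℓ (finalHeight (w′ ++ ℓ ∷ [])) ℓ′ t
    ≡⟨ cong (_∸ δ ℓ (finalHeight (w′ ++ ℓ ∷ [])) ℓ′ t) (profile-snoc w′ ℓ ℓ′ t) ⟩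
  profile w′ ℓ′ t + δ ℓ (finalHeight (w′ ++ ℓ ∷ [])) ℓ′ t ∸ δ ℓ (finalHeight (w′ ++ ℓ ∷ [])) ℓ′ t
    ≡⟨ ℕP.m+n∸n≡m (profile w′ ℓ′ t) (δ ℓ (finalHeight (w′ ++ ℓ ∷ [])) ℓ′ t) ⟩
  profile w′ ℓ′ t ∎
  where
  open ≡-Reasoning
  open Invariants (∼bal⇒Invariants w∼w′ℓ)

ending-class-card : ∀ R m ℓ w → length w ≡ suc m → (∀ v → length v ≡ m → HasCard (_∼bal v) (formula R (profile v))) →
  HasCard (λ u → u ∼bal w × EndsWith ℓ u) (ind (endable? ℓ w) * formula R (lower ℓ (finalHeight w) (profile w)))
ending-class-card R m ℓ w w↦1+m card with endable? ℓ w
... | no ¬endable = HasCard-∅ λ { u (u∼w , v , refl) →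
        ¬endable (Invariants⇒Endable ℓ (∼bal⇒Invariants u∼w) (snoc-Endable v ℓ)) }
... | yes endable =
  HasCard-cong same-class (subst (HasCard _) count (HasCard-image (_++ ℓ ∷ []) (proj₁ ∘ LP.∷ʳ-injective _ _) (card w′ w′↦m)))
  where
  w′ = proj₁ (Endable⇒∼snoc ℓ w endable)
  w∼w′ℓ = proj₂ (Endable⇒∼snoc ℓ w endable)
  w′↦m : length w′ ≡ m
  w′↦m = ℕP.suc-injective (trans (sym (length-snoc w′ ℓ)) (trans (sym (Invariants.length≡ (∼bal⇒Invariants w∼w′ℓ))) w↦1+m))
  count : formula R (profile w′) ≡ 1 * formula R (lower ℓ (finalHeight w) (profile w))
  count = trans (sym (formula-cong R (lower-profile ℓ w w′ w∼w′ℓ))) (sym (ℕP.*-identityˡ _))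
  same-class : ∀ u → (Σ[ v ∈ Word ] v ∼bal w′ × u ≡ v ++ ℓ ∷ []) ⇔ (u ∼bal w × EndsWith ℓ u)
  same-class u = mk⇔
    (λ { (v , v∼w′ , refl) → ∼bal.trans (∼bal-snoc (ℓ ∷ []) v∼w′) (∼bal.sym w∼w′ℓ) , v , refl })
    (λ { (u∼w , v , refl) → v , ∼bal-snoc-cancel ℓ (∼bal.trans u∼w w∼w′ℓ) , refl })

nonempty-Reachable : ∀ w → 0 < length w → let e = finalHeight w in Reachable e (profile w U e) (profile w D e)
nonempty-Reachable w nonempty with initLast w
nonempty-Reachable _ ()       | []
nonempty-Reachable _ nonempty | v ∷ʳ′ ℓ = snoc-Reachable v ℓ

nonempty-EndsWith : ∀ u → 0 < length u → EndsWith U u ⊎ EndsWith D u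
nonempty-EndsWith u nonempty with initLast u
nonempty-EndsWith _ ()       | []
nonempty-EndsWith _ nonempty | v ∷ʳ′ U = inj₁ (v , refl)
nonempty-EndsWith _ nonempty | v ∷ʳ′ D = inj₂ (v , refl)

∏<-ones : ∀ n → ∏< n (λ _ → 1) ≡ 1
∏<-ones zero    = refl
∏<-ones (suc n) = trans (∏<-suc n (λ _ → 1)) (cong (_* 1) (∏<-ones n))

empty-class-card : ∀ R → HasCard (_∼bal []) (formula R (profile []))
empty-class-card R = [] ∷ [] , [] ∷ [] , members , sym (cong (_* 1) (∏<-ones R))
  where
  members : ∀ u → (u ∈ [] ∷ []) ⇔ (u ∼bal [])
  members []      = mk⇔ (λ _ → ∼bal.refl) (λ _ → here refl)
  members (_ ∷ _) = mk⇔ (λ { (here ()) }) (λ u∼[] → ⊥-elim (ℕP.1+n≢0 (Invariants.length≡ (∼bal⇒Invariants u∼[]))))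

class-card : ∀ R w → length w < R → HasCard (_∼bal w) (formula R (profile w))
class-card R w = by-length (length w) w refl
  where
  by-length : ∀ n w → length w ≡ n → n < R → HasCard (_∼bal w) (formula R (profile w))
  by-length zero    []      _      _     = empty-class-card R
  by-length (suc m) w       w↦1+m  1+m<R =
    HasCard-cong by-last-letter (subst (HasCard _) total (HasCard-⊎ disjoint (ending U) (ending D)))
    where
    e = finalHeight w
    nonempty : 0 < length w
    nonempty = subst (0 <_) (sym w↦1+m) (s≤s z≤n)
    ending : ∀ ℓ → HasCard (λ u → u ∼bal w × EndsWith ℓ u) (ind (endable? ℓ w) * formula R (lower ℓ e (profile w)))
    ending ℓ = ending-class-card R m ℓ w w↦1+m (λ v v↦m → by-length m v v↦m (ℕP.<-trans (ℕP.n<1+n m) 1+m<R))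
    total : ind (endable? U w) * formula R (lower U e (profile w)) + ind (endable? D w) * formula R (lower D e (profile w))
          ≡ formula R (profile w)
    total = sym (formula-pascal R (profile w) e (ℕP.≤-trans (∣height∣≤ (+ 0) w) (subst (_≤ R) (sym w↦1+m) (ℕP.<⇒≤ 1+m<R)))
                                (nonempty-Reachable w nonempty))
    disjoint : ∀ u → u ∼bal w × EndsWith U u → u ∼bal w × EndsWith D u → ⊥
    disjoint u (_ , v , refl) (_ , v′ , u≡) with () ← proj₂ (LP.∷ʳ-injective v v′ u≡)
    by-last-letter : ∀ u → (u ∼bal w × EndsWith U u ⊎ u ∼bal w × EndsWith D u) ⇔ (u ∼bal w)
    by-last-letter u = mk⇔ [ proj₁ , proj₁ ] λ u∼w →
      ⊎-map (u∼w ,_) (u∼w ,_) (nonempty-EndsWith u (subst (0 <_) (sym (Invariants.length≡ (∼bal⇒Invariants u∼w))) nonempty))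

ind-<-up : ∀ h t → ind (h ℤ.≟ t) + ind (t ℤ.<? h) ≡ ind (t ℤ.<? h ℤ.+ + 1)
ind-<-up h t with h ℤ.≟ t
... | yes refl = trans (cong suc (ind-no (h ℤ.<? h) (ℤP.<-irrefl refl))) (sym (ind-yes (h ℤ.<? _) (<+1 h)))
... | no h≢t  = ind-cong (t ℤ.<? h) (t ℤ.<? _) (λ t<h → ℤP.<-trans t<h (<+1 h)) (λ t<h+1 → ℤP.≤∧≢⇒< (<+1⇒≤ t<h+1) (h≢t ∘ sym))

ind-<-down : ∀ h t → ind (t ℤ.<? h) ≡ ind (h ℤ.≟ ℤ.suc t) + ind (t ℤ.<? h ℤ.+ -[1+ 0 ])
ind-<-down h t with h ℤ.≟ ℤ.suc t
... | yes refl = trans (ind-yes (t ℤ.<? _) t<suc) (cong suc (sym (ind-no (t ℤ.<? _) λ t<t → ℤP.<-irrefl refl (subst (t ℤ.<_) back t<t))))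
  where
  t<suc : t ℤ.< ℤ.suc t
  t<suc = ℤP.suc[i]≤j⇒i<j ℤP.≤-refl
  back : ℤ.suc t ℤ.+ -[1+ 0 ] ≡ t
  back = trans (-1≡pred (ℤ.suc t)) (ℤP.pred-suc t)
... | no h≢suc = ind-cong (t ℤ.<? h) (t ℤ.<? _)
  (λ t<h → ℤP.suc[i]≤j⇒i<j (<⇒≤-1 (ℤP.≤∧≢⇒< (ℤP.i<j⇒suc[i]≤j t<h) (λ eq → h≢suc (sym eq)))))
  (λ t<h-1 → ℤP.<-≤-trans t<h-1 (-1≤ h))

-- Up- and down-crossings of the edge between t and t+1 alternate, so their difference depends only on the endpoints.
crossings : ∀ h w t → coeffFrom U h w t + ind (t ℤ.<? h) ≡ coeffFrom D h w (ℤ.suc t) + ind (t ℤ.<? height h w)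
crossings h []      t = refl
crossings h (U ∷ w) t = begin
  ind (h ℤ.≟ t) + ups + ind (t ℤ.<? h)           ≡⟨ cong (_+ ind (t ℤ.<? h)) (ℕP.+-comm (ind (h ℤ.≟ t)) ups) ⟩
  ups + ind (h ℤ.≟ t) + ind (t ℤ.<? h)           ≡⟨ ℕP.+-assoc ups _ _ ⟩
  ups + (ind (h ℤ.≟ t) + ind (t ℤ.<? h))         ≡⟨ cong (_+_ ups) (ind-<-up h t) ⟩
  ups + ind (t ℤ.<? h ℤ.+ + 1)                   ≡⟨ crossings (h ℤ.+ + 1) w t ⟩
  coeffFrom D (h ℤ.+ + 1) w (ℤ.suc t) + ind (t ℤ.<? height h (U ∷ w)) ∎
  where
  open ≡-Reasoning
  ups = coeffFrom U (h ℤ.+ + 1) w t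
crossings h (D ∷ w) t = begin
  ups + ind (t ℤ.<? h)                                      ≡⟨ cong (_+_ ups) (ind-<-down h t) ⟩
  ups + (ind (h ℤ.≟ ℤ.suc t) + ind (t ℤ.<? h′))             ≡⟨ x∙yz≈y∙xz ups (ind (h ℤ.≟ ℤ.suc t)) _ ⟩
  ind (h ℤ.≟ ℤ.suc t) + (ups + ind (t ℤ.<? h′))             ≡⟨ cong (_+_ (ind (h ℤ.≟ ℤ.suc t))) (crossings h′ w t) ⟩
  ind (h ℤ.≟ ℤ.suc t) + (coeffFrom D h′ w (ℤ.suc t) + ind (t ℤ.<? height h′ w))
                                                            ≡⟨ ℕP.+-assoc (ind (h ℤ.≟ ℤ.suc t)) _ _ ⟨
  ind (h ℤ.≟ ℤ.suc t) + coeffFrom D h′ w (ℤ.suc t) + ind (t ℤ.<? height h′ w) ∎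
  where
  open ≡-Reasoning
  h′ = h ℤ.+ -[1+ 0 ]
  ups = coeffFrom U h′ w t

C-sym : ∀ x y → (x + y) C x ≡ (y + x) C y
C-sym x y = trans (nCk≡nC[n∸k] (ℕP.m≤m+n x y)) (cong₂ _C_ (ℕP.+-comm x y) (ℕP.m+n∸m≡n x y))

finalHeight≡⊖ : ∀ w → finalHeight w ≡ #U w ⊖ #D w
finalHeight≡⊖ w = trans (height-counts (+ 0) w) (ℤP.+-identityˡ _)

Rising⇒0<finalHeight : ∀ w → #D w < #U w → + 0 ℤ.< finalHeight w
Rising⇒0<finalHeight w D<U = subst (+ 0 ℤ.<_) (sym (trans (finalHeight≡⊖ w) (ℤP.⊖-≥ (ℕP.<⇒≤ D<U)))) (ℤ.+<+ (ℕP.m<n⇒0<n∸m D<U))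

Falling⇒finalHeight<0 : ∀ w → #U w < #D w → finalHeight w ℤ.< + 0
Falling⇒finalHeight<0 w U<D = subst (ℤ._< + 0) (sym (trans (finalHeight≡⊖ w) (ℤP.⊖-< U<D))) (ℤP.neg-mono-< (ℤ.+<+ (ℕP.m<n⇒0<n∸m U<D)))

module _ (w : Word) where
  private
    α  = a w -[1+ 0 ]
    β  = b w (+ 1)
    a₀ = a w (+ 0)
    b₀ = b w (+ 0)
    e  = finalHeight w

  α≡b₀ : -[1+ 0 ] ℤ.< e → α ≡ b₀
  α≡b₀ -1<e = ℕP.+-cancelʳ-≡ 1 α b₀ (trans (crossings (+ 0) w -[1+ 0 ]) (cong (_+_ b₀) (ind-yes (-[1+ 0 ] ℤ.<? e) -1<e)))

  b₀≡1+α : ¬ -[1+ 0 ] ℤ.< e → b₀ ≡ suc α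
  b₀≡1+α -1≮e = begin
    b₀                                ≡⟨ ℕP.+-identityʳ b₀ ⟨
    b₀ + 0                            ≡⟨ cong (_+_ b₀) (ind-no (-[1+ 0 ] ℤ.<? e) -1≮e) ⟨
    b₀ + ind (-[1+ 0 ] ℤ.<? e)        ≡⟨ crossings (+ 0) w -[1+ 0 ] ⟨
    α + 1                             ≡⟨ ℕP.+-comm α 1 ⟩
    suc α                             ∎
    where open ≡-Reasoning

  a₀≡1+β : + 0 ℤ.< e → a₀ ≡ suc β
  a₀≡1+β 0<e = begin
    a₀                                ≡⟨ ℕP.+-identityʳ a₀ ⟨
    a₀ + 0                            ≡⟨ crossings (+ 0) w (+ 0) ⟩
    β + ind (+ 0 ℤ.<? e)              ≡⟨ cong (_+_ β) (ind-yes (+ 0 ℤ.<? e) 0<e) ⟩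
    β + 1                             ≡⟨ ℕP.+-comm β 1 ⟩
    suc β                             ∎
    where open ≡-Reasoning

  a₀≡β : ¬ + 0 ℤ.< e → a₀ ≡ β
  a₀≡β 0≮e = begin
    a₀                                ≡⟨ ℕP.+-identityʳ a₀ ⟨
    a₀ + 0                            ≡⟨ crossings (+ 0) w (+ 0) ⟩
    β + ind (+ 0 ℤ.<? e)              ≡⟨ cong (_+_ β) (ind-no (+ 0 ℤ.<? e) 0≮e) ⟩
    β + 0                             ≡⟨ ℕP.+-identityʳ β ⟩
    β                                 ∎
    where open ≡-Reasoning

  caseFactor≡levelTerm : caseFactor w ≡ levelTerm (profile w) (+ 0)
  caseFactor≡levelTerm with #U w ℕ.≟ #D w
  ... | yes balanced = begin
    (a₀ + b₀) C a₀     ≡⟨ C-sym a₀ b₀ ⟩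
    (b₀ + a₀) C b₀     ≡⟨ cong₂ (λ x y → (x + y) C x) (sym (α≡b₀ (subst (-[1+ 0 ] ℤ.<_) (sym e≡0) ℤ.-<+)))
                                                       (a₀≡β (ℤP.<-irrefl (sym e≡0))) ⟩
    (α + β) C α        ∎
    where
    open ≡-Reasoning
    e≡0 : e ≡ + 0
    e≡0 = Balanced⇒height≡ (+ 0) w balanced
  ... | no unbalanced with #D w ℕ.≤? #U w
  ...   | yes rising = begin
    binom-1 a₀ b₀ b₀       ≡⟨ cong (λ x → binom-1 x b₀ b₀) (a₀≡1+β 0<e) ⟩
    binom-1 (suc β) b₀ b₀  ≡⟨ cong (_C b₀) (ℕP.+-comm β b₀) ⟩
    (b₀ + β) C b₀          ≡⟨ cong (λ x → (x + β) C x) (sym (α≡b₀ (ℤP.<-trans ℤ.-<+ 0<e))) ⟩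
    (α + β) C α            ∎
    where
    open ≡-Reasoning
    0<e : + 0 ℤ.< e
    0<e = Rising⇒0<finalHeight w (ℕP.≤∧≢⇒< rising (unbalanced ∘ sym))
  ...   | no ¬rising = begin
    binom-1 a₀ b₀ a₀       ≡⟨ cong₂ (λ x y → binom-1 x y x) (a₀≡β (ℤP.<-asym e<0)) (b₀≡1+α -1≮e) ⟩
    binom-1 β (suc α) β    ≡⟨ cong (λ n → binomℤ (+ n ℤ.- + 1) β) (ℕP.+-suc β α) ⟩
    (β + α) C β            ≡⟨ C-sym β α ⟩
    (α + β) C α            ∎
    where
    open ≡-Reasoning
    e<0 : e ℤ.< + 0
    e<0 = Falling⇒finalHeight<0 w (ℕP.≰⇒> ¬rising)
    -1≮e : ¬ -[1+ 0 ] ℤ.< e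
    -1≮e -1<e = ℤP.<-irrefl refl (ℤP.<-≤-trans e<0 (ℤP.i<j⇒suc[i]≤j -1<e))

factor≡levelPair : ∀ w i → factor w i ≡ levelPair (levelTerm (profile w)) i
factor≡levelPair w zero    = refl
factor≡levelPair w (suc i) rewrite ℕP.+-comm i 2 = refl

theorem6p14 : (w : Word) → HasCard (λ u → u ∼bal w) (infProduct w * caseFactor w)
theorem6p14 w = subst (HasCard (_∼bal w)) (sym infProduct*caseFactor≡formula) (class-card R w ℕP.≤-refl)
  where
  R = suc (length w)
  infProduct*caseFactor≡formula : infProduct w * caseFactor w ≡ formula R (profile w)
  infProduct*caseFactor≡formula = cong₂ _*_ (∏<-cong R (λ i _ → factor≡levelPair w i)) (caseFactor≡levelTerm w)
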